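{- For the elementary cellular automaton $F_{32}$ and every nonempty finite word $u\in\{0,1\}^*$, $D(\textsc{SInv}_{F_{32},u,n})\in O(1)$ as $n\to\infty$.
   Context: The ECA with Wolfram number $N$ is $F_N:\{0,1\}^{\mathbb{Z}}\to\{0,1\}^{\mathbb{Z}}$, $(F_N(x))_i=f_N(x_{i-1},x_i,x_{i+1})$, where $f_N(a,b,c)$ is the bit of index $4a+2b+c$ of $N$ in binary. For a nonempty word $u$, $p_u\in\{0,1\}^{\mathbb{Z}}$ is $(p_u)_i=u_{i\bmod |u|}$; for a finite word $x$, $p_u[x]$ equals $x$ on positions $\{0,\dots,|x|-1\}$ and $p_u$ elsewhere. $\textsc{SInv}_{F,u,n}:\{0,1\}^n\to\{0,1\}$ maps $x$ to $1$ iff there is an integer $w$ such that for every $t\ge 0$ the set of positions where $F^t(p_u)$ and $F^t(p_u[x])$ differ is contained in an interval of length $w$. For finite sets $X,Y,Z$ and $g:X\times Y\to Z$, $D(g)$ is the minimal depth of a deterministic two-party communication protocol tree computing $g$ (Alice knows $x$, Bob knows $y$; internal nodes are labelled by a function of $x$ alone or of $y$ alone to $\{\mathrm{l},\mathrm{r}\}$, leaves by outputs). For $g:\{0,1\}^m\to Z$, $D(g)=\max_{0\le i\le m} D(g_i)$ with $g_i(x,y)=g(xy)$ for $x\in\{0,1\}^i$, $y\in\{0,1\}^{m-i}$. -}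

module Defs where

open import Data.Bool using (Bool; true; false; if_then_else_)
open import Data.Nat as ℕ using (ℕ; zero; suc)
open import Data.Nat.DivMod using (_%_; _/_)
open import Data.Integer as ℤ using (ℤ; +_; -[1+_])
open import Data.Integer.DivMod using (_%ℕ_; n%ℕd<d)
open import Data.Fin using (Fin; fromℕ<)
open import Data.Vec using (Vec; lookup)
open import Data.List using (List; []; _∷_)
open import Data.Product using (Σ; ∃; _×_)
open import Relation.Binary.PropositionalEquality using (_≡_; _≢_)

bit : ℕ → ℕ → Bool
bit N zero    = N % 2 ℕ.≡ᵇ 1
bit N (suc k) = bit (N / 2) k

toℕ : Bool → ℕ
toℕ false = 0
toℕ true  = 1

localRule : ℕ → Bool → Bool → Bool → Bool
localRule N a b c = bit N (4 ℕ.* toℕ a ℕ.+ 2 ℕ.* toℕ b ℕ.+ toℕ c)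

Config : Set
Config = ℤ → Bool

ECA : ℕ → Config → Config
ECA N x i = localRule N (x (i ℤ.- ℤ.1ℤ)) (x i) (x (i ℤ.+ ℤ.1ℤ))

iterate : (Config → Config) → ℕ → Config → Config
iterate F zero    x = x
iterate F (suc t) x = F (iterate F t x)

periodic : ∀ {k} → Vec Bool (suc k) → Config
periodic {k} u i = lookup u (fromℕ< (n%ℕd<d i (suc k)))

data MaybeBool : Set where
  none : MaybeBool
  some : Bool → MaybeBool

at : List Bool → ℕ → MaybeBool
at []      _       = none
at (b ∷ _) zero    = some b
at (_ ∷ w) (suc m) = at w m

patch : ∀ {k} → Vec Bool (suc k) → List Bool → Config
patch u x (+ m) with at x m
... | none   = periodic u (+ m)
... | some b = b
patch u x -[1+ m ] = periodic u -[1+ m ]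

-- SInv_{F_N,u,|x|}(x) = 1 : the differences between F^t(p_u) and F^t(p_u[x])
-- stay, for all t, inside an interval {a, ..., a+w-1} of length w
SInv : ℕ → ∀ {k} → Vec Bool (suc k) → List Bool → Set
SInv N u x =
  ∃ λ (w : ℕ) → (t : ℕ) → ∃ λ (a : ℤ) → (i : ℤ) →
    iterate (ECA N) t (periodic u) i ≢ iterate (ECA N) t (patch u x) i →
    (a ℤ.≤ i) × (i ℤ.< a ℤ.+ + w)

-- deterministic two-party protocol trees: Alice holds x : X, Bob holds y : Y
data Protocol (X Y Z : Set) : Set where
  leaf  : Z → Protocol X Y Z
  alice : (X → Bool) → Protocol X Y Z → Protocol X Y Z → Protocol X Y Z
  bob   : (Y → Bool) → Protocol X Y Z → Protocol X Y Z → Protocol X Y Z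

-- false = l, true = r
depth : ∀ {X Y Z} → Protocol X Y Z → ℕ
depth (leaf _)      = 0
depth (alice _ l r) = suc (depth l ℕ.⊔ depth r)
depth (bob _ l r)   = suc (depth l ℕ.⊔ depth r)

run : ∀ {X Y Z} → Protocol X Y Z → X → Y → Z
run (leaf z)      x y = z
run (alice f l r) x y = if f x then run r x y else run l x y
run (bob g l r)   x y = if g y then run r x y else run l x y

-- Under rule 32 a cell is 1 at time t exactly when the initial configuration reads 1010…101 on
-- the 2t+1 cells below it.  If p_u has two equal neighbours somewhere, then by periodicity every
-- window of |u|+1 cells contains such a pair, so any configuration that equals p_u outside a block
-- of length n is identically 0 from time |u|+n on; before that the differences stay inside the
-- light cone of the block.  Hence SInv holds for every word and a leaf decides it.  Otherwise p_u
-- alternates, and one mismatch of p_u[x] with p_u at position i makes F^t(p_u) and F^t(p_u[x])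
-- differ at every L+t with p_u(L) = 1 and i-2t ≤ L ≤ i, a set of unbounded width.  So SInv(x)
-- holds iff x agrees with p_u, which Alice and Bob check on their halves with two bits.

module Submission where

open import Defs
open import Data.Nat using (ℕ; suc)

module Locality (N : ℕ) where
  open import Data.Nat as ℕ using (zero; z≤n; s≤s)
  import Data.Nat.Properties as ℕP
  open import Data.Integer using (ℤ; +_; _+_; _-_; -_; _<_; _≤_; 1ℤ; +≤+)
  import Data.Integer.Properties as ℤP
  open import Data.Integer.Tactic.RingSolver using (solve-∀)
  open import Data.Sum using (_⊎_; inj₁; inj₂)
  open import Relation.Nullary using (yes; no)
  open import Data.Empty using (⊥-elim)
  open import Relation.Binary.PropositionalEquality
  open import Data.Product using (_×_; _,_)

  Outside : ℤ → ℤ → ℤ → Set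
  Outside lo hi j = j < lo ⊎ hi ≤ j

  +-assoc-suc : ∀ a k → a + + k + 1ℤ ≡ a + + suc k
  +-assoc-suc a k = trans (ℤP.+-assoc a (+ k) 1ℤ) (cong (_+_ a) (ℤP.+-comm (+ k) 1ℤ))

  at-centre : ∀ {P : ℤ → Set} i t → P (i - + t + + t) → P i
  at-centre {P} i t = subst P (recentre i (+ t))
    where
    recentre : ∀ i t → i - t + t ≡ i
    recentre = solve-∀

  localRule-cong : ∀ {a a' b b' c c'} → a ≡ a' → b ≡ b' → c ≡ c' →
                   localRule N a b c ≡ localRule N a' b' c'
  localRule-cong refl refl refl = refl

  iterate-suc-window : ∀ t c a →
    iterate (ECA N) (suc t) c (a + + suc t) ≡
    localRule N (iterate (ECA N) t c (a + + t))
                (iterate (ECA N) t c (a + 1ℤ + + t))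
                (iterate (ECA N) t c (a + + 2 + + t))
  iterate-suc-window t c a = localRule-cong (cong F (left a (+ t)))
                                            (cong F (sym (ℤP.+-assoc a 1ℤ (+ t))))
                                            (cong F (right a (+ t)))
    where
    F = iterate (ECA N) t c
    left : ∀ a t → a + (1ℤ + t) - 1ℤ ≡ a + t
    left = solve-∀
    right : ∀ a t → a + (1ℤ + t) + 1ℤ ≡ a + + 2 + t
    right = solve-∀

  window-weaken : ∀ {k} t → k ℕ.≤ t ℕ.+ t → k ℕ.≤ suc t ℕ.+ suc t
  window-weaken t k≤ = ℕP.≤-trans k≤ (ℕP.+-mono-≤ (ℕP.n≤1+n t) (ℕP.n≤1+n t))

  sub-window : ∀ {P : ℕ → ℤ → Set} t a → (∀ k → k ℕ.≤ suc t ℕ.+ suc t → P k (a + + k)) →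
               ∀ s → s ℕ.≤ 2 → ∀ k → k ℕ.≤ t ℕ.+ t → P (s ℕ.+ k) (a + + s + + k)
  sub-window {P} t a h s s≤2 k k≤ =
    subst (P (s ℕ.+ k)) (sym (ℤP.+-assoc a (+ s) (+ k))) (h (s ℕ.+ k) (ℕP.≤-trans (ℕP.+-mono-≤ s≤2 k≤) two+t+t))
    where
    two+t+t : 2 ℕ.+ (t ℕ.+ t) ℕ.≤ suc t ℕ.+ suc t
    two+t+t = ℕP.≤-reflexive (cong suc (sym (ℕP.+-suc t t)))

  light-cone : ∀ t {c c'} a → (∀ k → k ℕ.≤ t ℕ.+ t → c (a + + k) ≡ c' (a + + k)) →
               iterate (ECA N) t c (a + + t) ≡ iterate (ECA N) t c' (a + + t)
  light-cone zero a agree = agree 0 z≤n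
  light-cone (suc t) {c} {c'} a agree =
    trans (iterate-suc-window t c a)
      (trans (localRule-cong (light-cone t a (λ k k≤ → agree k (window-weaken t k≤)))
                             (light-cone t (a + 1ℤ) (shifted 1 (s≤s z≤n)))
                             (light-cone t (a + + 2) (shifted 2 ℕP.≤-refl)))
             (sym (iterate-suc-window t c' a)))
    where
    shifted : ∀ s → s ℕ.≤ 2 → ∀ k → k ℕ.≤ t ℕ.+ t → c (a + + s + + k) ≡ c' (a + + s + + k)
    shifted = sub-window {λ _ j → c j ≡ c' j} t a agree

  light-cone-at : ∀ t {c c'} i → (∀ k → k ℕ.≤ t ℕ.+ t → c (i - + t + + k) ≡ c' (i - + t + + k)) →
                  iterate (ECA N) t c i ≡ iterate (ECA N) t c' i
  light-cone-at t {c} {c'} i agree =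
    at-centre {λ j → iterate (ECA N) t c j ≡ iterate (ECA N) t c' j} i t (light-cone t (i - + t) agree)

  iterate-cong : ∀ {c c'} → (∀ j → c j ≡ c' j) → ∀ t i → iterate (ECA N) t c i ≡ iterate (ECA N) t c' i
  iterate-cong agree t i = light-cone-at t i (λ _ _ → agree _)

  light-cone-outside : ∀ t {c c'} lo hi i → (∀ j → Outside lo hi j → c j ≡ c' j) →
                       Outside (lo - + t) (hi + + t) i → iterate (ECA N) t c i ≡ iterate (ECA N) t c' i
  light-cone-outside t lo hi i agree (inj₁ i<lo-t) = light-cone-at t i λ k k≤ → agree _ (inj₁ (
    ℤP.≤-<-trans (ℤP.+-monoʳ-≤ (i - + t) (+≤+ k≤))
      (subst₂ _<_ (widest i (+ t)) (cancel lo (+ t)) (ℤP.+-monoˡ-< (+ t) i<lo-t))))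
    where
    widest : ∀ i t → i + t ≡ i - t + (t + t)
    widest = solve-∀
    cancel : ∀ lo t → lo - t + t ≡ lo
    cancel = solve-∀
  light-cone-outside t lo hi i agree (inj₂ hi+t≤i) = light-cone-at t i λ k _ → agree _ (inj₂ (
    ℤP.≤-trans (subst (_≤ i - + t) (cancel hi (+ t)) (ℤP.+-monoˡ-≤ (- + t) hi+t≤i))
               (ℤP.i≤i+j (i - + t) (+ k))))
    where
    cancel : ∀ hi t → hi + t - t ≡ hi
    cancel = solve-∀

  difference⇒inside-light-cone : ∀ t {c c'} lo hi i → (∀ j → Outside lo hi j → c j ≡ c' j) →
    iterate (ECA N) t c i ≢ iterate (ECA N) t c' i → (lo - + t ≤ i) × (i < hi + + t)
  difference⇒inside-light-cone t lo hi i agree diff with i ℤP.<? lo - + t | hi + + t ℤP.≤? i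
  ... | yes below | _        = ⊥-elim (diff (light-cone-outside t lo hi i agree (inj₁ below)))
  ... | no _      | yes above = ⊥-elim (diff (light-cone-outside t lo hi i agree (inj₂ above)))
  ... | no ¬below | no ¬above = ℤP.≮⇒≥ ¬below , ℤP.≰⇒> ¬above

module Rule32 where
  open import Data.Bool using (Bool; true; false; not)
  open import Data.Bool.Properties using (not-¬; ¬-not; not-injective)
  open import Data.Nat as ℕ using (zero; z≤n; s≤s)
  import Data.Nat.Properties as ℕP
  open import Data.Integer using (ℤ; +_; _+_; _-_; _<_; _≤_; 0ℤ; 1ℤ; +≤+)
  import Data.Integer.Properties as ℤP
  open import Data.Product using (∃; _×_; _,_; proj₁; proj₂)
  open import Data.Sum using (inj₁; inj₂)
  open import Relation.Nullary using (yes; no)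
  open import Relation.Binary.PropositionalEquality
  open import Data.Integer.Tactic.RingSolver using (solve-∀)
  open Locality 32

  Stutter : Config → ℤ → Set
  Stutter c s = c s ≡ c (s + 1ℤ)

  Alternating : Config → Set
  Alternating c = ∀ s → c (s + 1ℤ) ≡ not (c s)

  StuttersWithin : ℕ → Config → Set
  StuttersWithin m c = ∀ a → ∃ λ j → j ℕ.< m × Stutter c (a + + j)

  evenᵇ : ℕ → Bool
  evenᵇ zero          = true
  evenᵇ (suc zero)    = false
  evenᵇ (suc (suc k)) = evenᵇ k

  evenᵇ-suc : ∀ k → evenᵇ (suc k) ≡ not (evenᵇ k)
  evenᵇ-suc zero          = refl
  evenᵇ-suc (suc zero)    = refl
  evenᵇ-suc (suc (suc k)) = evenᵇ-suc k

  evenᵇ-double : ∀ k → evenᵇ (k ℕ.+ k) ≡ true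
  evenᵇ-double zero    = refl
  evenᵇ-double (suc k) = trans (cong evenᵇ (cong suc (ℕP.+-suc k k))) (evenᵇ-double k)

  rule32-true⇒101 : ∀ a b c → localRule 32 a b c ≡ true → (a ≡ true) × (b ≡ false) × (c ≡ true)
  rule32-true⇒101 true  false true  _  = refl , refl , refl
  rule32-true⇒101 true  true  true  ()
  rule32-true⇒101 true  true  false ()
  rule32-true⇒101 true  false false ()
  rule32-true⇒101 false true  true  ()
  rule32-true⇒101 false true  false ()
  rule32-true⇒101 false false true  ()
  rule32-true⇒101 false false false ()

  rule32-step : ∀ t c a → iterate (ECA 32) (suc t) c (a + + suc t) ≡ true →
    (iterate (ECA 32) t c (a + + t) ≡ true) × (iterate (ECA 32) t c (a + 1ℤ + + t) ≡ false) ×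
    (iterate (ECA 32) t c (a + + 2 + + t) ≡ true)
  rule32-step t c a h = rule32-true⇒101 _ _ _ (trans (sym (iterate-suc-window t c a)) h)

  window-shrink : ∀ {k} t → suc (suc k) ℕ.≤ suc t ℕ.+ suc t → k ℕ.≤ t ℕ.+ t
  window-shrink {k} t (s≤s k≤) = ℕ.s≤s⁻¹ (subst (suc k ℕ.≤_) (ℕP.+-suc t t) k≤)

  rule32-window : ∀ t c a → iterate (ECA 32) t c (a + + t) ≡ true →
                  ∀ k → k ℕ.≤ t ℕ.+ t → c (a + + k) ≡ evenᵇ k
  rule32-window zero          c a h zero                _  = h
  rule32-window (suc t)       c a h zero                _  = rule32-window t c a (proj₁ (rule32-step t c a h)) 0 z≤n
  rule32-window (suc zero)    c a h (suc zero)          _  =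
    trans (cong c (sym (ℤP.+-assoc a 1ℤ (+ 0)))) (proj₁ (proj₂ (rule32-step 0 c a h)))
  rule32-window (suc (suc t)) c a h (suc zero)          _  =
    rule32-window (suc t) c a (proj₁ (rule32-step (suc t) c a h)) 1 (s≤s z≤n)
  rule32-window (suc t)       c a h (suc (suc k)) k≤ =
    trans (cong c (sym (ℤP.+-assoc a (+ 2) (+ k))))
          (rule32-window t c (a + + 2) (proj₂ (proj₂ (rule32-step t c a h))) k (window-shrink t k≤))

  rule32-window⁻¹ : ∀ t c a → (∀ k → k ℕ.≤ t ℕ.+ t → c (a + + k) ≡ evenᵇ k) →
                    iterate (ECA 32) t c (a + + t) ≡ true
  rule32-window⁻¹ zero    c a evens = evens 0 z≤n
  rule32-window⁻¹ (suc t) c a evens =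
    trans (iterate-suc-window t c a)
          (localRule-cong (rule32-window⁻¹ t c a (λ k k≤ → evens k (window-weaken t k≤)))
                          middle
                          (rule32-window⁻¹ t c (a + + 2) (shifted 2 ℕP.≤-refl)))
    where
    shifted : ∀ s → s ℕ.≤ 2 → ∀ k → k ℕ.≤ t ℕ.+ t → c (a + + s + + k) ≡ evenᵇ (s ℕ.+ k)
    shifted = sub-window {λ k j → c j ≡ evenᵇ k} t a evens
    middle : iterate (ECA 32) t c (a + 1ℤ + + t) ≡ false
    middle = ¬-not λ true-there →
      not-¬ refl (trans (sym (rule32-window t c (a + 1ℤ) true-there 0 z≤n)) (shifted 1 (s≤s z≤n) 0 z≤n))

  stutter⇒rule32-false : ∀ t c a k → Stutter c (a + + k) → suc k ℕ.≤ t ℕ.+ t →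
                         iterate (ECA 32) t c (a + + t) ≡ false
  stutter⇒rule32-false t c a k stutter k<2t = ¬-not λ true-there →
    let evens = rule32-window t c a true-there in
    not-¬ refl (begin
      evenᵇ k           ≡⟨ sym (evens k (ℕP.<⇒≤ k<2t)) ⟩
      c (a + + k)       ≡⟨ stutter ⟩
      c (a + + k + 1ℤ)  ≡⟨ cong c (+-assoc-suc a k) ⟩
      c (a + + suc k)   ≡⟨ evens (suc k) k<2t ⟩
      evenᵇ (suc k)     ≡⟨ evenᵇ-suc k ⟩
      not (evenᵇ k)     ∎)
    where open ≡-Reasoning

  alternating-from-true : ∀ {c} → Alternating c → ∀ {a} → c a ≡ true → ∀ k → c (a + + k) ≡ evenᵇ k
  alternating-from-true {c} alt {a} ca zero    = trans (cong c (ℤP.+-identityʳ a)) ca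
  alternating-from-true {c} alt {a} ca (suc k) = begin
    c (a + + suc k)    ≡⟨ cong c (sym (+-assoc-suc a k)) ⟩
    c (a + + k + 1ℤ)   ≡⟨ alt (a + + k) ⟩
    not (c (a + + k))  ≡⟨ cong not (alternating-from-true alt ca k) ⟩
    not (evenᵇ k)      ≡⟨ sym (evenᵇ-suc k) ⟩
    evenᵇ (suc k)      ∎
    where open ≡-Reasoning

  alternating-true-nearby : ∀ {c} → Alternating c → ∀ x → ∃ λ e → e ℕ.≤ 1 × c (x - + e) ≡ true
  alternating-true-nearby {c} alt x with c x in cx
  ... | true  = 0 , z≤n , trans (cong c (ℤP.+-identityʳ x)) cx
  ... | false = 1 , ℕP.≤-refl , not-injective (trans (sym (alt (x - 1ℤ))) (trans (cong c (cancel x)) cx))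
    where
    cancel : ∀ x → x - 1ℤ + 1ℤ ≡ x
    cancel = solve-∀

  mismatch⇒difference : ∀ {e c} t L k → Alternating e → e L ≡ true → c (L + + k) ≢ e (L + + k) →
    k ℕ.≤ t ℕ.+ t → iterate (ECA 32) t e (L + + t) ≢ iterate (ECA 32) t c (L + + t)
  mismatch⇒difference {e} {c} t L k alt eL mismatch k≤ same =
    mismatch (trans (rule32-window t c L c-true k k≤) (sym (e-evens k)))
    where
    e-evens = alternating-from-true alt eL
    c-true : iterate (ECA 32) t c (L + + t) ≡ true
    c-true = trans (sym same) (rule32-window⁻¹ t e L (λ k _ → e-evens k))

  vanishes : ∀ {e c m n t} → StuttersWithin m e → (∀ j → Outside 0ℤ (+ n) j → c j ≡ e j) →
             m ℕ.+ n ℕ.≤ t → ∀ i → iterate (ECA 32) t c i ≡ false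
  vanishes {e} {c} {m} {n} {t} stutters agree m+n≤t i =
    at-centre {λ j → iterate (ECA 32) t c j ≡ false} i t (from-left (i - + t))
    where
    m≤t : m ℕ.≤ t
    m≤t = ℕP.≤-trans (ℕP.m≤m+n m n) m+n≤t
    transfer : ∀ s → Outside 0ℤ (+ n) s → Outside 0ℤ (+ n) (s + 1ℤ) → Stutter e s → Stutter c s
    transfer s out out+1 st = trans (agree s out) (trans st (sym (agree (s + 1ℤ) out+1)))
    -- Either the first m+1 cells of the window [a, a+2t] lie left of 0, or the m+1 cells from
    -- offset m+n on lie right of n; in both places c copies e and so has a stutter.
    from-left : ∀ a → iterate (ECA 32) t c (a + + t) ≡ false
    from-left a with a + + m ℤP.<? 0ℤ | stutters a | stutters (a + + (m ℕ.+ n))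
    ... | yes a+m<0 | j , j<m , st | _ =
      stutter⇒rule32-false t c a j (transfer _ (inj₁ (ℤP.≤-<-trans (ℤP.i≤i+j _ 1ℤ) s+1<0)) (inj₁ s+1<0) st)
        (ℕP.≤-trans j<m (ℕP.≤-trans m≤t (ℕP.m≤m+n t t)))
      where
      s+1<0 : a + + j + 1ℤ < 0ℤ
      s+1<0 = ℤP.≤-<-trans (ℤP.≤-trans (ℤP.≤-reflexive (+-assoc-suc a j)) (ℤP.+-monoʳ-≤ a (+≤+ j<m))) a+m<0
    ... | no a+m≮0 | _ | j , j<m , st =
      stutter⇒rule32-false t c a (m ℕ.+ n ℕ.+ j)
        (subst (Stutter c) (ℤP.+-assoc a (+ (m ℕ.+ n)) (+ j))
               (transfer _ (inj₂ n≤s) (inj₂ (ℤP.≤-trans n≤s (ℤP.i≤i+j _ 1ℤ))) st))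
        (subst (ℕ._≤ t ℕ.+ t) (ℕP.+-suc (m ℕ.+ n) j) (ℕP.+-mono-≤ m+n≤t (ℕP.≤-trans j<m m≤t)))
      where
      n≤s : + n ≤ a + + (m ℕ.+ n) + + j
      n≤s = ℤP.≤-trans (ℤP.≤-trans (ℤP.+-monoˡ-≤ (+ n) (ℤP.≮⇒≥ a+m≮0))
                                   (ℤP.≤-reflexive (ℤP.+-assoc a (+ m) (+ n))))
                       (ℤP.i≤i+j _ (+ j))

module Matching where
  open import Data.Bool using (Bool; true; false; _∧_)
  open import Data.Bool.Properties using (_≟_; ∧-assoc)
  open import Data.Nat as ℕ using (zero)
  import Data.Nat.Properties as ℕP
  open import Data.Integer using (+_)
  open import Data.List using (List; []; _∷_; _++_; length)
  open import Data.Product using (∃; _×_; _,_)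
  open import Relation.Nullary using (yes; no; does)
  open import Function using (_∘_)
  open import Relation.Binary.PropositionalEquality

  matchesFrom : Config → ℕ → List Bool → Bool
  matchesFrom c o []      = true
  matchesFrom c o (b ∷ z) = does (b ≟ c (+ o)) ∧ matchesFrom c (suc o) z

  matchesFrom-++ : ∀ c o xs ys →
    matchesFrom c o (xs ++ ys) ≡ matchesFrom c o xs ∧ matchesFrom c (o ℕ.+ length xs) ys
  matchesFrom-++ c o []       ys = cong (λ o' → matchesFrom c o' ys) (sym (ℕP.+-identityʳ o))
  matchesFrom-++ c o (b ∷ xs) ys = begin
    b≟ ∧ matchesFrom c (suc o) (xs ++ ys)
      ≡⟨ cong (b≟ ∧_) (matchesFrom-++ c (suc o) xs ys) ⟩
    b≟ ∧ (matchesFrom c (suc o) xs ∧ matchesFrom c (suc o ℕ.+ length xs) ys)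
      ≡⟨ sym (∧-assoc b≟ _ _) ⟩
    (b≟ ∧ matchesFrom c (suc o) xs) ∧ matchesFrom c (suc o ℕ.+ length xs) ys
      ≡⟨ cong (λ o' → (b≟ ∧ matchesFrom c (suc o) xs) ∧ matchesFrom c o' ys) (sym (ℕP.+-suc o (length xs))) ⟩
    (b≟ ∧ matchesFrom c (suc o) xs) ∧ matchesFrom c (o ℕ.+ suc (length xs)) ys ∎
    where
    open ≡-Reasoning
    b≟ = does (b ≟ c (+ o))

  matchesFrom-sound : ∀ c o z → matchesFrom c o z ≡ true →
                      ∀ d {b} → at z d ≡ some b → b ≡ c (+ (o ℕ.+ d))
  matchesFrom-sound c o (b ∷ z) matches d at≡ with b ≟ c (+ o)
  matchesFrom-sound c o (b ∷ z) matches zero    refl | yes b≡ = trans b≡ (cong (c ∘ +_) (sym (ℕP.+-identityʳ o)))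
  matchesFrom-sound c o (b ∷ z) matches (suc d) at≡  | yes _  =
    trans (matchesFrom-sound c (suc o) z matches d at≡) (cong (c ∘ +_) (sym (ℕP.+-suc o d)))

  matchesFrom-false : ∀ c o z → matchesFrom c o z ≡ false →
                      ∃ λ d → ∃ λ b → at z d ≡ some b × b ≢ c (+ (o ℕ.+ d))
  matchesFrom-false c o (b ∷ z) mismatch with b ≟ c (+ o)
  ... | no b≢  = 0 , b , refl , subst (λ d → b ≢ c (+ d)) (sym (ℕP.+-identityʳ o)) b≢
  ... | yes _ with matchesFrom-false c (suc o) z mismatch
  ...   | d , b' , at≡ , b'≢ = suc d , b' , at≡ , subst (λ d' → b' ≢ c (+ d')) (sym (ℕP.+-suc o d)) b'≢

  at-beyond : ∀ (z : List Bool) {d} → length z ℕ.≤ d → at z d ≡ none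
  at-beyond []      _                  = refl
  at-beyond (_ ∷ z) {suc d} (ℕ.s≤s le) = at-beyond z le

module Periodic where
  open import Data.Bool using (Bool; true; false; not)
  open import Data.Bool.Properties using (¬-not) renaming (_≟_ to _≟ᵇ_)
  open import Data.Nat as ℕ using (NonZero)
  import Data.Nat.Properties as ℕP
  open import Data.Nat.DivMod using ([m+kn]%n≡m%n; m<n⇒m%n≡m)
  open import Data.Integer using (+_; -[1+_]; _+_; _-_; -_; _*_; _<_; _≤_; 0ℤ; 1ℤ; +≤+; +<+; _%ℕ_; _/ℕ_)
  import Data.Integer.Properties as ℤP
  open import Data.Integer.DivMod using (n%ℕd<d; a≡a%ℕn+[a/ℕn]*n)
  open import Data.Integer.Tactic.RingSolver using (solve-∀)
  open import Data.Fin as Fin using (Fin; fromℕ<)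
  open import Data.Fin.Properties using (any?; fromℕ<-cong; toℕ-fromℕ<)
  open import Data.Vec using (Vec; lookup)
  open import Data.List using (length)
  open import Data.Product using (∃; _×_; _,_; proj₁; proj₂)
  open import Data.Sum using (_⊎_; inj₁; inj₂)
  open import Data.Empty using (⊥-elim)
  open import Function.Bundles using (_⇔_; mk⇔)
  open import Relation.Nullary using (¬_; yes; no)
  open import Relation.Binary.PropositionalEquality
  open Locality 32
  open Rule32
  open Matching

  remainder-unique : ∀ {m r r'} .{{_ : NonZero m}} q → r ℕ.< m → r' ℕ.< m → + r ≡ + r' + q * + m → r ≡ r'
  remainder-unique {m} {r} {r'} (+ e) r<m r'<m r≡ = begin
    r                       ≡⟨ sym (m<n⇒m%n≡m r<m) ⟩
    r ℕ.% m                 ≡⟨ cong (ℕ._% m) (ℤP.+-injective (trans r≡ (cong (_+_ (+ r')) (sym (ℤP.pos-* e m))))) ⟩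
    (r' ℕ.+ e ℕ.* m) ℕ.% m  ≡⟨ [m+kn]%n≡m%n r' e m ⟩
    r' ℕ.% m                ≡⟨ m<n⇒m%n≡m r'<m ⟩
    r'                      ∎
    where open ≡-Reasoning
  remainder-unique {m} {r} {r'} -[1+ e ] r<m r'<m r≡ =
    sym (remainder-unique (+ suc e) r'<m r<m (trans (unshift (+ r') (+ suc e) (+ m)) (cong (_+ + suc e * + m) (sym r≡))))
    where
    unshift : ∀ r' q m → r' ≡ r' + (- q) * m + q * m
    unshift = solve-∀

  module _ {k} (u : Vec Bool (suc k)) where

    private
      m : ℕ
      m = suc k

    periodic-congruent : ∀ {i j} q → i ≡ j + q * + m → periodic u i ≡ periodic u j
    periodic-congruent {i} {j} q i≡ =
      cong (lookup u) (fromℕ<-cong _ _ (remainder-unique (j /ℕ m + q - i /ℕ m) (n%ℕd<d i m) (n%ℕd<d j m) rem≡) _ _)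
      where
      open ≡-Reasoning
      split : ∀ r q m → r ≡ r + q * m - q * m
      split = solve-∀
      collect : ∀ r qj q qi m → r + qj * m + q * m - qi * m ≡ r + (qj + q - qi) * m
      collect = solve-∀
      rem≡ : + (i %ℕ m) ≡ + (j %ℕ m) + (j /ℕ m + q - i /ℕ m) * + m
      rem≡ = begin
        + (i %ℕ m)                                          ≡⟨ split (+ (i %ℕ m)) (i /ℕ m) (+ m) ⟩
        + (i %ℕ m) + i /ℕ m * + m - i /ℕ m * + m            ≡⟨ cong (_- i /ℕ m * + m) (sym (a≡a%ℕn+[a/ℕn]*n i m)) ⟩
        i - i /ℕ m * + m                                    ≡⟨ cong (_- i /ℕ m * + m) i≡ ⟩
        j + q * + m - i /ℕ m * + m                          ≡⟨ cong (λ j' → j' + q * + m - i /ℕ m * + m) (a≡a%ℕn+[a/ℕn]*n j m) ⟩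
        + (j %ℕ m) + j /ℕ m * + m + q * + m - i /ℕ m * + m  ≡⟨ collect (+ (j %ℕ m)) (j /ℕ m) q (i /ℕ m) (+ m) ⟩
        + (j %ℕ m) + (j /ℕ m + q - i /ℕ m) * + m            ∎

    stutter-or-alternating : (∃ λ s → Stutter (periodic u) s) ⊎ Alternating (periodic u)
    stutter-or-alternating with any? (λ (r : Fin m) → periodic u (+ Fin.toℕ r) ≟ᵇ periodic u (+ Fin.toℕ r + 1ℤ))
    ... | yes (r , stutter) = inj₁ (+ Fin.toℕ r , stutter)
    ... | no no-stutter     = inj₂ alternating
      where
      alternating : Alternating (periodic u)
      alternating s = begin
        periodic u (s + 1ℤ)   ≡⟨ periodic-congruent {j = ρ + 1ℤ} q (trans (cong (_+ 1ℤ) s≡) (reorder ρ q (+ m))) ⟩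
        periodic u (ρ + 1ℤ)   ≡⟨ ¬-not (λ eq → no-stutter (r , sym eq)) ⟩
        not (periodic u ρ)    ≡⟨ cong not (sym (periodic-congruent {j = ρ} q s≡)) ⟩
        not (periodic u s)    ∎
        where
        open ≡-Reasoning
        r = fromℕ< (n%ℕd<d s m)
        ρ = + Fin.toℕ r
        q = s /ℕ m
        s≡ : s ≡ ρ + q * + m
        s≡ = trans (a≡a%ℕn+[a/ℕn]*n s m) (cong (λ r' → + r' + q * + m) (sym (toℕ-fromℕ< _)))
        reorder : ∀ r q m → r + q * m + 1ℤ ≡ r + 1ℤ + q * m
        reorder = solve-∀

    stutter⇒stutters-within : ∀ s → Stutter (periodic u) s → StuttersWithin m (periodic u)
    stutter⇒stutters-within s stutter a = j , n%ℕd<d (s - a) m , (begin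
      periodic u (a + + j)       ≡⟨ periodic-congruent {j = s} (- q) a+j≡ ⟩
      periodic u s               ≡⟨ stutter ⟩
      periodic u (s + 1ℤ)        ≡⟨ sym (periodic-congruent {j = s + 1ℤ} (- q) a+j+1≡) ⟩
      periodic u (a + + j + 1ℤ)  ∎)
      where
      open ≡-Reasoning
      j = (s - a) %ℕ m
      q = (s - a) /ℕ m
      expand : ∀ a j q m → a + j ≡ (j + q * m) + a + (- q) * m
      expand = solve-∀
      cancel : ∀ s a x → s - a + a + x ≡ s + x
      cancel = solve-∀
      reorder : ∀ s q m → s + q * m + 1ℤ ≡ s + 1ℤ + q * m
      reorder = solve-∀
      a+j≡ : a + + j ≡ s + (- q) * + m
      a+j≡ = begin
        a + + j                            ≡⟨ expand a (+ j) q (+ m) ⟩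
        (+ j + q * + m) + a + (- q) * + m  ≡⟨ cong (λ x → x + a + (- q) * + m) (sym (a≡a%ℕn+[a/ℕn]*n (s - a) m)) ⟩
        (s - a) + a + (- q) * + m          ≡⟨ cancel s a (- q * + m) ⟩
        s + (- q) * + m                    ∎
      a+j+1≡ : a + + j + 1ℤ ≡ s + 1ℤ + (- q) * + m
      a+j+1≡ = trans (cong (_+ 1ℤ) a+j≡) (reorder s (- q) (+ m))

    patch-outside : ∀ z j → Outside 0ℤ (+ length z) j → patch u z j ≡ periodic u j
    patch-outside z -[1+ _ ] _                = refl
    patch-outside z (+ d)    (inj₁ (+<+ ()))
    patch-outside z (+ d)    (inj₂ (+≤+ n≤d)) rewrite at-beyond z n≤d = refl

    patch-at : ∀ z d {b} → at z d ≡ some b → patch u z (+ d) ≡ b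
    patch-at z d at≡ rewrite at≡ = refl

    matching⇒patch≗periodic : ∀ z → matchesFrom (periodic u) 0 z ≡ true → ∀ j → patch u z j ≡ periodic u j
    matching⇒patch≗periodic z matches -[1+ _ ] = refl
    matching⇒patch≗periodic z matches (+ d) with at z d in at≡
    ... | none   = refl
    ... | some b = matchesFrom-sound (periodic u) 0 z matches d at≡

    mismatch⇒patch≢periodic : ∀ z → matchesFrom (periodic u) 0 z ≡ false → ∃ λ i → patch u z i ≢ periodic u i
    mismatch⇒patch≢periodic z mismatch with matchesFrom-false (periodic u) 0 z mismatch
    ... | d , b , at≡ , b≢ = + d , subst (_≢ periodic u (+ d)) (sym (patch-at z d at≡)) b≢

    stutter⇒SInv : ∀ s → Stutter (periodic u) s → ∀ z → SInv 32 u z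
    stutter⇒SInv s stutter z = T ℕ.+ (n ℕ.+ T) , λ t → 0ℤ - + T , bounded t
      where
      n = length z
      T = m ℕ.+ n
      vanish : ∀ {c t} → (∀ j → Outside 0ℤ (+ n) j → c j ≡ periodic u j) → T ℕ.≤ t →
               ∀ i → iterate (ECA 32) t c i ≡ false
      vanish = vanishes (stutter⇒stutters-within s stutter)
      bounded : ∀ t i → iterate (ECA 32) t (periodic u) i ≢ iterate (ECA 32) t (patch u z) i →
                (0ℤ - + T ≤ i) × (i < 0ℤ - + T + + (T ℕ.+ (n ℕ.+ T)))
      bounded t i diff with T ℕ.≤? t
      ... | yes T≤t = ⊥-elim (diff (trans (vanish (λ _ _ → refl) T≤t i) (sym (vanish (patch-outside z) T≤t i))))
      ... | no T≰t with difference⇒inside-light-cone t 0ℤ (+ n) i (λ j out → sym (patch-outside z j out)) diff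
      ...   | lo≤i , i<hi =
        ℤP.≤-trans (ℤP.+-monoʳ-≤ 0ℤ (ℤP.neg-mono-≤ (+≤+ t≤T))) lo≤i ,
        ℤP.<-≤-trans i<hi (ℤP.≤-trans (ℤP.+-monoʳ-≤ (+ n) (+≤+ t≤T)) (ℤP.≤-reflexive (widen (+ n) (+ T))))
        where
        t≤T : t ℕ.≤ T
        t≤T = ℕP.<⇒≤ (ℕP.≰⇒> T≰t)
        widen : ∀ n T → n + T ≡ 0ℤ - T + (T + (n + T))
        widen = solve-∀

    matching⇒SInv : ∀ z → matchesFrom (periodic u) 0 z ≡ true → SInv 32 u z
    matching⇒SInv z matches = 0 , λ t → 0ℤ , λ i diff →
      ⊥-elim (diff (iterate-cong (λ j → sym (matching⇒patch≗periodic z matches j)) t i))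

    mismatch⇒¬SInv : Alternating (periodic u) → ∀ z i → patch u z i ≢ periodic u i → ¬ SInv 32 u z
    mismatch⇒¬SInv alt z i mismatch (w , confined)
      with alternating-true-nearby alt (i - + (w ℕ.+ w))
    -- At time w+1 there are differences at L₁+t and at L₂+t = L₁+t+2w: too far apart for width w.
    ... | e , e≤1 , p[L₁]≡true = ℤP.<-irrefl refl (begin-strict
      D₂                <⟨ proj₂ (inside D₂ diff₂) ⟩
      a + + w           ≤⟨ ℤP.+-monoˡ-≤ (+ w) (proj₁ (inside D₁ diff₁)) ⟩
      D₁ + + w          ≤⟨ ℤP.+-monoʳ-≤ D₁ (+≤+ (ℕP.m≤n+m w w)) ⟩
      D₁ + + (w ℕ.+ w)  ≡⟨ swap L₁ (+ t) (+ (w ℕ.+ w)) ⟩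
      D₂                ∎)
      where
      open ℤP.≤-Reasoning
      reach₁ : ∀ i W e → i - W - e + (e + W) ≡ i
      reach₁ = solve-∀
      reach₂ : ∀ i W e → i - W - e + W + e ≡ i
      reach₂ = solve-∀
      swap : ∀ L t W → L + t + W ≡ L + W + t
      swap = solve-∀
      t = suc w
      a = proj₁ (confined t)
      inside = proj₂ (confined t)
      L₁ = i - + (w ℕ.+ w) - + e
      L₂ = L₁ + + (w ℕ.+ w)
      D₁ = L₁ + + t
      D₂ = L₂ + + t
      p[L₂]≡true : periodic u L₂ ≡ true
      p[L₂]≡true = trans (alternating-from-true alt {L₁} p[L₁]≡true (w ℕ.+ w)) (evenᵇ-double w)
      mismatch-at : ∀ L k → L + + k ≡ i → patch u z (L + + k) ≢ periodic u (L + + k)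
      mismatch-at L k L+k≡i = subst (λ j → patch u z j ≢ periodic u j) (sym L+k≡i) mismatch
      k₁≤ : e ℕ.+ (w ℕ.+ w) ℕ.≤ t ℕ.+ t
      k₁≤ = ℕP.≤-trans (ℕP.+-monoˡ-≤ (w ℕ.+ w) (ℕP.≤-trans e≤1 (ℕP.n≤1+n 1)))
                       (ℕP.≤-reflexive (cong suc (sym (ℕP.+-suc w w))))
      diff₁ = mismatch⇒difference t L₁ (e ℕ.+ (w ℕ.+ w)) alt p[L₁]≡true
                (mismatch-at L₁ _ (reach₁ i (+ (w ℕ.+ w)) (+ e))) k₁≤
      diff₂ = mismatch⇒difference t L₂ e alt p[L₂]≡true
                (mismatch-at L₂ _ (reach₂ i (+ (w ℕ.+ w)) (+ e))) (ℕP.≤-trans (ℕP.m≤m+n e (w ℕ.+ w)) k₁≤)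

    alternating⇒matches⇔SInv : Alternating (periodic u) → ∀ z → (matchesFrom (periodic u) 0 z ≡ true) ⇔ SInv 32 u z
    alternating⇒matches⇔SInv alt z with matchesFrom (periodic u) 0 z in matches
    ... | true  = mk⇔ (λ _ → matching⇒SInv z matches) (λ _ → refl)
    ... | false with mismatch⇒patch≢periodic z matches
    ...   | i , differs = mk⇔ (λ ()) (λ sinv → ⊥-elim (mismatch⇒¬SInv alt z i differs sinv))

open import Data.Bool using (Bool; true; false; _∧_; if_then_else_)
open import Data.Nat using (_+_; _≤_; z≤n)
open import Data.Nat.Properties using (≤-refl)
open import Data.Vec using (Vec; toList)
open import Data.Vec.Properties using (length-toList)
open import Data.List using (_++_)
open import Data.Product using (∃; _×_; _,_)
open import Data.Sum using (inj₁; inj₂)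
open import Function.Bundles using (_⇔_; mk⇔)
open import Relation.Binary.PropositionalEquality using (_≡_; refl; sym; trans; cong; subst)
open Matching using (matchesFrom; matchesFrom-++)
open Periodic using (stutter-or-alternating; stutter⇒SInv; alternating⇒matches⇔SInv)

matchProtocol : ∀ {k} → Vec Bool (suc k) → ∀ i j → Protocol (Vec Bool i) (Vec Bool j) Bool
matchProtocol u i j =
  alice (λ x → matchesFrom (periodic u) 0 (toList x)) (leaf false)
        (bob (λ y → matchesFrom (periodic u) i (toList y)) (leaf false) (leaf true))

run-matchProtocol : ∀ {k} (u : Vec Bool (suc k)) {i j} (x : Vec Bool i) (y : Vec Bool j) →
  run (matchProtocol u i j) x y ≡ matchesFrom (periodic u) 0 (toList x ++ toList y)
run-matchProtocol u x y =
  trans (if-conjunction (matchesFrom (periodic u) 0 (toList x)) _)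
        (trans (cong (λ o → matchesFrom (periodic u) 0 (toList x) ∧ matchesFrom (periodic u) o (toList y))
                     (sym (length-toList x)))
               (sym (matchesFrom-++ (periodic u) 0 (toList x) (toList y))))
  where
  if-conjunction : ∀ a b → (if a then (if b then true else false) else false) ≡ a ∧ b
  if-conjunction false _     = refl
  if-conjunction true  true  = refl
  if-conjunction true  false = refl

proposition11 : ∀ (k : ℕ) (u : Vec Bool (suc k)) →
    ∃ λ (N₀ : ℕ) → ∃ λ (C : ℕ) → ∀ (n : ℕ) → N₀ ≤ n →
      ∀ (i j : ℕ) → i + j ≡ n →
        ∃ λ (T : Protocol (Vec Bool i) (Vec Bool j) Bool) →
          (depth T ≤ C) ×
          (∀ (x : Vec Bool i) (y : Vec Bool j) →
            (run T x y ≡ true) ⇔ SInv 32 u (toList x ++ toList y))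
proposition11 k u with stutter-or-alternating u
... | inj₁ (s , stutter) = 0 , 0 , λ _ _ i j _ → leaf true , z≤n , λ x y →
  mk⇔ (λ _ → stutter⇒SInv u s stutter _) (λ _ → refl)
... | inj₂ alternating   = 0 , 2 , λ _ _ i j _ → matchProtocol u i j , ≤-refl , λ x y →
  subst (λ b → (b ≡ true) ⇔ SInv 32 u (toList x ++ toList y))
        (sym (run-matchProtocol u x y))
        (alternating⇒matches⇔SInv u alternating _)
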